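{- Let $d\geq 2$ and $t\geq 1$, and consider the modified $d$-neighbour bootstrap percolation process on $\mathbb{Z}^d$ with an arbitrary initially infected set. Suppose that the origin is protected and that for some $1\leq r\leq t$ the sphere $S_r$ contains exactly two protected sites. Then there exists $i\in[d]$ such that $P(B_r)=\{se_i:-r\leq s\leq r\}$.
   Context: In the modified $d$-neighbour process on $\mathbb{Z}^d$ with initial set $A$, $A_0=A$ and $A_{s+1}=A_s\cup\{v:\text{for all } i\in[d],\ |A_s\cap\{v-e_i,v+e_i\}|\geq 1\}$, where $e_i$ are the standard basis vectors. $\|x\|$ is the $\ell_1$ norm, $B_r=\{y:\|y\|\leq r\}$, $S_r=\{y:\|y\|=r\}$. For fixed $t$, $x\in B_t$ is protected if it is not in $A_{t-\|x\|}$; $P(X)$ is the set of protected sites in $X$. -}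

module Defs where

open import Data.Nat as ℕ using (ℕ; zero; suc; _∸_)
open import Data.Integer as ℤ using (ℤ; +_; ∣_∣)
open import Data.Fin using (Fin; _≟_)
open import Data.Vec using (Vec; tabulate; zipWith; map; replicate)
open import Data.Vec using () renaming (sum to vsum)
open import Data.Product using (_×_)
open import Data.Sum using (_⊎_)
open import Relation.Nullary using (¬_; yes; no)
open import Level using (Level)

Point : ℕ → Set
Point d = Vec ℤ d

e : ∀ {d} → Fin d → Point d
e i = tabulate λ j → case j
  where
  case : _ → ℤ
  case j with i ≟ j
  ... | yes _ = + 1
  ... | no  _ = + 0

origin : ∀ {d} → Point d
origin = replicate _ (+ 0)

_⊕_ : ∀ {d} → Point d → Point d → Point d
_⊕_ = zipWith ℤ._+_

_⊖_ : ∀ {d} → Point d → Point d → Point d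
_⊖_ = zipWith ℤ._-_

_·_ : ∀ {d} → ℤ → Point d → Point d
s · x = map (s ℤ.*_) x

‖_‖ : ∀ {d} → Point d → ℕ
‖ x ‖ = vsum (map ∣_∣ x)

Step : ∀ {d} → (Point d → Set) → ℕ → Point d → Set
Step A zero v = A v
Step {d} A (suc s) v =
  Step A s v ⊎ ((i : Fin d) → Step A s (v ⊖ e i) ⊎ Step A s (v ⊕ e i))

Protected : ∀ {d} → (Point d → Set) → ℕ → Point d → Set
Protected A t x = (‖ x ‖ ℕ.≤ t) × ¬ Step A (t ∸ ‖ x ‖) x

module Submission where

-- A protected x with ‖x‖ < t was not infected at time t - ‖x‖, so by the update rule some
-- direction j is open at x (both x ± e_j uninfected one step earlier), and the outward one of
-- x ± e_j is protected.  Iterating, every protected point of B_r extends to a protected point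
-- of S_r keeping the signs of its nonzero coordinates.  Points on opposite sides of a
-- coordinate hyperplane have distinct extensions, so no three pairwise opposite protected
-- points exist; hence no protected point has an open direction along which it vanishes while
-- another protected point lies opposite to it.  From the origin this yields one axis j on which
-- ±e_j, then ±2e_j, …, ±r·e_j are protected; the last two are the protected points of S_r,
-- and every protected point of B_r is on the axis, as an off-axis coordinate would survive in
-- its extension to S_r.  Protection is a negative statement, so the argument runs in the
-- double-negation monad.

open import Defs
open import Data.Nat as ℕ using (ℕ; zero; suc; _∸_; _≤_; _≥_; z≤n; s≤s)
import Data.Nat.Properties as ℕP
open import Data.Nat.Tactic.RingSolver using (solve-∀)
open import Data.Integer as ℤ using (ℤ; +_; -_; ∣_∣; +[1+_]; -[1+_]; 0ℤ)
import Data.Integer.Properties as ℤP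
open import Data.Fin as Fin using (Fin; _≟_)
import Data.Fin.Properties as FinP
open import Data.Vec using (Vec; []; _∷_; lookup; tabulate; zipWith)
import Data.Vec.Properties as VecP
open import Data.Product using (_×_; Σ; _,_; proj₁; proj₂)
open import Data.Sum using (_⊎_; inj₁; inj₂)
open import Data.Empty using (⊥; ⊥-elim)
open import Function.Base using (_∋_; _∘_)
open import Effect.Monad using (RawMonad)
open import Level using (0ℓ)
open import Relation.Nullary using (¬_; yes; no)
open import Relation.Nullary.Negation using (¬¬-Monad; ¬¬-map)
open import Relation.Nullary.Decidable using (decidable-stable)
open import Relation.Binary.PropositionalEquality

¬¬-∀-Fin : ∀ {n} {P : Fin n → Set} → (∀ i → ¬ ¬ P i) → ¬ ¬ (∀ i → P i)
¬¬-∀-Fin {zero}  _   all = all (λ ())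
¬¬-∀-Fin {suc n} ¬¬P = do
  p₀ ← ¬¬P Fin.zero
  ps ← ¬¬-∀-Fin (¬¬P ∘ Fin.suc)
  pure (FinP.∀-cons p₀ ps)
  where open RawMonad (¬¬-Monad {0ℓ})

pigeonhole : ∀ {a} {X : Set a} {y z p q s : X} →
  (p ≡ y ⊎ p ≡ z) → (q ≡ y ⊎ q ≡ z) → (s ≡ y ⊎ s ≡ z) → p ≢ q → p ≢ s → q ≢ s → ⊥
pigeonhole (inj₁ p≡y) (inj₁ q≡y) _          p≢q _   _   = p≢q (trans p≡y (sym q≡y))
pigeonhole (inj₂ p≡z) (inj₂ q≡z) _          p≢q _   _   = p≢q (trans p≡z (sym q≡z))
pigeonhole (inj₁ p≡y) _          (inj₁ s≡y) _   p≢s _   = p≢s (trans p≡y (sym s≡y))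
pigeonhole (inj₂ p≡z) _          (inj₂ s≡z) _   p≢s _   = p≢s (trans p≡z (sym s≡z))
pigeonhole _          (inj₁ q≡y) (inj₁ s≡y) _   _   q≢s = q≢s (trans q≡y (sym s≡y))
pigeonhole _          (inj₂ q≡z) (inj₂ s≡z) _   _   q≢s = q≢s (trans q≡z (sym s≡z))

coordinatewise : ∀ {d} {x y : Point d} → (∀ k → lookup x k ≡ lookup y k) → x ≡ y
coordinatewise {x = x} {y} same = begin
  x                  ≡⟨ VecP.tabulate∘lookup x ⟨
  tabulate (lookup x) ≡⟨ VecP.tabulate-cong same ⟩
  tabulate (lookup y) ≡⟨ VecP.tabulate∘lookup y ⟩
  y                  ∎
  where open ≡-Reasoning

lookup-e-same : ∀ {d} (j : Fin d) → lookup (e j) j ≡ + 1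
lookup-e-same j rewrite (lookup (e j) j ≡ _ ∋ VecP.lookup∘tabulate _ j) with j ≟ j
... | yes _   = refl
... | no j≢j = ⊥-elim (j≢j refl)

lookup-e-other : ∀ {d} {j k : Fin d} → j ≢ k → lookup (e j) k ≡ + 0
lookup-e-other {j = j} {k} j≢k rewrite (lookup (e j) k ≡ _ ∋ VecP.lookup∘tabulate _ k) with j ≟ k
... | yes j≡k = ⊥-elim (j≢k j≡k)
... | no _    = refl

lookup-axis-same : ∀ {d} (s : ℤ) (j : Fin d) → lookup (s · e j) j ≡ s
lookup-axis-same s j = begin
  lookup (s · e j) j   ≡⟨ VecP.lookup-map j (s ℤ.*_) (e j) ⟩
  s ℤ.* lookup (e j) j ≡⟨ cong (s ℤ.*_) (lookup-e-same j) ⟩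
  s ℤ.* + 1            ≡⟨ ℤP.*-identityʳ s ⟩
  s                    ∎
  where open ≡-Reasoning

lookup-axis-other : ∀ {d} (s : ℤ) {j k : Fin d} → j ≢ k → lookup (s · e j) k ≡ + 0
lookup-axis-other s {j} {k} j≢k = begin
  lookup (s · e j) k   ≡⟨ VecP.lookup-map k (s ℤ.*_) (e j) ⟩
  s ℤ.* lookup (e j) k ≡⟨ cong (s ℤ.*_) (lookup-e-other j≢k) ⟩
  s ℤ.* + 0            ≡⟨ ℤP.*-zeroʳ s ⟩
  + 0                  ∎
  where open ≡-Reasoning

origin-on-axis : ∀ {d} (j : Fin d) → origin ≡ (+ 0) · e j
origin-on-axis j = coordinatewise λ k → trans (VecP.lookup-replicate k (+ 0))
  (sym (trans (VecP.lookup-map k (+ 0 ℤ.*_) (e j)) (ℤP.*-zeroˡ (lookup (e j) k))))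

-- A unit move x ↦ x ⊕ e j or x ↦ x ⊖ e j has the form zipWith op x (e j) for an
-- operation op with op a 0 = a; it changes the j-th coordinate only.
module UnitMove (op : ℤ → ℤ → ℤ) (op-identityʳ : ∀ a → op a (+ 0) ≡ a) where

  move-same : ∀ {d} (x : Point d) j → lookup (zipWith op x (e j)) j ≡ op (lookup x j) (+ 1)
  move-same x j = begin
    lookup (zipWith op x (e j)) j   ≡⟨ VecP.lookup-zipWith op j x (e j) ⟩
    op (lookup x j) (lookup (e j) j) ≡⟨ cong (op (lookup x j)) (lookup-e-same j) ⟩
    op (lookup x j) (+ 1)            ∎
    where open ≡-Reasoning

  move-other : ∀ {d} (x : Point d) {j k} → j ≢ k → lookup (zipWith op x (e j)) k ≡ lookup x k
  move-other x {j} {k} j≢k = begin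
    lookup (zipWith op x (e j)) k   ≡⟨ VecP.lookup-zipWith op k x (e j) ⟩
    op (lookup x k) (lookup (e j) k) ≡⟨ cong (op (lookup x k)) (lookup-e-other j≢k) ⟩
    op (lookup x k) (+ 0)            ≡⟨ op-identityʳ (lookup x k) ⟩
    lookup x k                       ∎
    where open ≡-Reasoning

  move-axis : ∀ {d} (s : ℤ) (j : Fin d) → zipWith op (s · e j) (e j) ≡ op s (+ 1) · e j
  move-axis s j = coordinatewise coordinate
    where
    coordinate : ∀ k → lookup (zipWith op (s · e j) (e j)) k ≡ lookup (op s (+ 1) · e j) k
    coordinate k with j ≟ k
    ... | yes refl = trans (move-same (s · e j) j)
                       (trans (cong (λ a → op a (+ 1)) (lookup-axis-same s j))
                              (sym (lookup-axis-same (op s (+ 1)) j)))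
    ... | no j≢k   = trans (move-other (s · e j) j≢k)
                       (trans (lookup-axis-other s j≢k) (sym (lookup-axis-other (op s (+ 1)) j≢k)))

open UnitMove ℤ._+_ ℤP.+-identityʳ public
  renaming (move-same to ⊕-same; move-other to ⊕-other; move-axis to ⊕-axis)
open UnitMove ℤ._-_ ℤP.+-identityʳ public
  renaming (move-same to ⊖-same; move-other to ⊖-other; move-axis to ⊖-axis)

‖‖-change : ∀ {n} (x x′ : Vec ℤ n) j → (∀ k → j ≢ k → lookup x k ≡ lookup x′ k) →
  ‖ x′ ‖ ℕ.+ ∣ lookup x j ∣ ≡ ‖ x ‖ ℕ.+ ∣ lookup x′ j ∣
‖‖-change (a ∷ x) (a′ ∷ x′) Fin.zero agree
  rewrite coordinatewise {x = x} {x′} (λ k → agree (Fin.suc k) (λ ()))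
  = swap-outer (∣ a′ ∣) (‖ x′ ‖) (∣ a ∣)
  where
  swap-outer : ∀ p s q → (p ℕ.+ s) ℕ.+ q ≡ (q ℕ.+ s) ℕ.+ p
  swap-outer = solve-∀
‖‖-change (a ∷ x) (a′ ∷ x′) (Fin.suc j) agree rewrite agree Fin.zero (λ ()) = begin
  (∣ a′ ∣ ℕ.+ ‖ x′ ‖) ℕ.+ ∣ lookup x j ∣  ≡⟨ ℕP.+-assoc ∣ a′ ∣ ‖ x′ ‖ _ ⟩
  ∣ a′ ∣ ℕ.+ (‖ x′ ‖ ℕ.+ ∣ lookup x j ∣)  ≡⟨ cong (∣ a′ ∣ ℕ.+_) (‖‖-change x x′ j agree-tail) ⟩
  ∣ a′ ∣ ℕ.+ (‖ x ‖ ℕ.+ ∣ lookup x′ j ∣)  ≡⟨ ℕP.+-assoc ∣ a′ ∣ ‖ x ‖ _ ⟨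
  (∣ a′ ∣ ℕ.+ ‖ x ‖) ℕ.+ ∣ lookup x′ j ∣  ∎
  where
  open ≡-Reasoning
  agree-tail : ∀ k → j ≢ k → lookup x k ≡ lookup x′ k
  agree-tail k j≢k = agree (Fin.suc k) (λ eq → j≢k (FinP.suc-injective eq))

‖origin‖ : ∀ {d} → ‖ origin {d} ‖ ≡ 0
‖origin‖ {zero}  = refl
‖origin‖ {suc d} = ‖origin‖ {d}

‖axis‖ : ∀ {d} (s : ℤ) (j : Fin d) → ‖ s · e j ‖ ≡ ∣ s ∣
‖axis‖ {d} s j = begin
  ‖ s · e j ‖                            ≡⟨ ℕP.+-identityʳ _ ⟨
  ‖ s · e j ‖ ℕ.+ 0                      ≡⟨ cong (λ a → ‖ s · e j ‖ ℕ.+ ∣ a ∣) (VecP.lookup-replicate j (+ 0)) ⟨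
  ‖ s · e j ‖ ℕ.+ ∣ lookup origin j ∣    ≡⟨ ‖‖-change origin (s · e j) j agree ⟩
  ‖ origin {d} ‖ ℕ.+ ∣ lookup (s · e j) j ∣ ≡⟨ cong₂ (λ m a → m ℕ.+ ∣ a ∣) (‖origin‖ {d}) (lookup-axis-same s j) ⟩
  ∣ s ∣                                  ∎
  where
  open ≡-Reasoning
  agree : ∀ k → j ≢ k → lookup origin k ≡ lookup (s · e j) k
  agree k j≢k = trans (VecP.lookup-replicate k (+ 0)) (sym (lookup-axis-other s j≢k))

‖‖-grow : ∀ {d} (x x′ : Point d) j → (∀ k → j ≢ k → lookup x k ≡ lookup x′ k) →
  ∣ lookup x′ j ∣ ≡ suc ∣ lookup x j ∣ → ‖ x′ ‖ ≡ suc ‖ x ‖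
‖‖-grow x x′ j agree grows = ℕP.+-cancelʳ-≡ ∣ lookup x j ∣ _ _ (begin
  ‖ x′ ‖ ℕ.+ ∣ lookup x j ∣       ≡⟨ ‖‖-change x x′ j agree ⟩
  ‖ x ‖ ℕ.+ ∣ lookup x′ j ∣       ≡⟨ cong (‖ x ‖ ℕ.+_) grows ⟩
  ‖ x ‖ ℕ.+ suc ∣ lookup x j ∣    ≡⟨ ℕP.+-suc ‖ x ‖ _ ⟩
  suc ‖ x ‖ ℕ.+ ∣ lookup x j ∣    ∎)
  where open ≡-Reasoning

∣+1∣ : ∀ {a} → 0ℤ ℤ.≤ a → ∣ a ℤ.+ + 1 ∣ ≡ suc ∣ a ∣
∣+1∣ (ℤ.+≤+ {n = n} _) = ℕP.+-comm n 1

∣-1∣ : ∀ {a} → a ℤ.≤ 0ℤ → ∣ a ℤ.- + 1 ∣ ≡ suc ∣ a ∣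
∣-1∣ (ℤ.-≤+ {m = m})   = cong (λ n → suc (suc n)) (ℕP.+-identityʳ m)
∣-1∣ (ℤ.+≤+ z≤n)       = refl

∣∣≤⇒bounded : ∀ {s r} → ∣ s ∣ ≤ r → - (+ r) ℤ.≤ s × s ℤ.≤ + r
∣∣≤⇒bounded {+ n}      n≤r       = ℤP.neg-≤-pos , ℤ.+≤+ n≤r
∣∣≤⇒bounded { -[1+ n ]} (s≤s n≤r) = ℤ.-≤- n≤r , ℤ.-≤+

bounded⇒∣∣≤ : ∀ {s r} → - (+ r) ℤ.≤ s → s ℤ.≤ + r → ∣ s ∣ ≤ r
bounded⇒∣∣≤ {+ n}                  _          (ℤ.+≤+ n≤r) = n≤r
bounded⇒∣∣≤ { -[1+ n ]} {r = suc r} (ℤ.-≤- n≤r) _          = s≤s n≤r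

‖⊕‖ : ∀ {d} (x : Point d) j → 0ℤ ℤ.≤ lookup x j → ‖ x ⊕ e j ‖ ≡ suc ‖ x ‖
‖⊕‖ x j 0≤xⱼ = ‖‖-grow x (x ⊕ e j) j (λ k j≢k → sym (⊕-other x j≢k))
  (trans (cong ∣_∣ (⊕-same x j)) (∣+1∣ 0≤xⱼ))

‖⊖‖ : ∀ {d} (x : Point d) j → lookup x j ℤ.≤ 0ℤ → ‖ x ⊖ e j ‖ ≡ suc ‖ x ‖
‖⊖‖ x j xⱼ≤0 = ‖‖-grow x (x ⊖ e j) j (λ k j≢k → sym (⊖-other x j≢k))
  (trans (cong ∣_∣ (⊖-same x j)) (∣-1∣ xⱼ≤0))

nonzero-coordinate : ∀ {n} (x : Vec ℤ n) → ‖ x ‖ ≢ 0 → Σ (Fin n) λ k → lookup x k ≢ + 0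
nonzero-coordinate []            ‖x‖≢0 = ⊥-elim (‖x‖≢0 refl)
nonzero-coordinate (+[1+ _ ] ∷ _) _    = Fin.zero , λ ()
nonzero-coordinate (-[1+ _ ] ∷ _) _    = Fin.zero , λ ()
nonzero-coordinate (+ 0 ∷ x)     ‖x‖≢0 with nonzero-coordinate x ‖x‖≢0
... | k , xₖ≢0 = Fin.suc k , xₖ≢0

SignKept : ℤ → ℤ → Set
SignKept a b = (0ℤ ℤ.< a → 0ℤ ℤ.< b) × (a ℤ.< 0ℤ → b ℤ.< 0ℤ)

-- w extends the sign pattern of x.  Outward paths only ever extend sign patterns,
-- which is what lets us compare far-away protected points with nearby ones.
record _≼_ {d} (x w : Point d) : Set where
  constructor signs-kept
  field sign-kept : ∀ k → SignKept (lookup x k) (lookup w k)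
open _≼_

≼-refl : ∀ {d} (x : Point d) → x ≼ x
≼-refl x = signs-kept λ k → (λ pos → pos) , (λ neg → neg)

≼-trans : ∀ {d} {x y w : Point d} → x ≼ y → y ≼ w → x ≼ w
≼-trans x≼y y≼w = signs-kept λ k →
  (λ pos → proj₁ (sign-kept y≼w k) (proj₁ (sign-kept x≼y k) pos)) ,
  (λ neg → proj₂ (sign-kept y≼w k) (proj₂ (sign-kept x≼y k) neg))

≼-change : ∀ {d} (x x′ : Point d) j → (∀ k → j ≢ k → lookup x k ≡ lookup x′ k) →
  SignKept (lookup x j) (lookup x′ j) → x ≼ x′
≼-change x x′ j agree kept = signs-kept coordinate
  where
  coordinate : ∀ k → SignKept (lookup x k) (lookup x′ k)
  coordinate k with j ≟ k
  ... | yes refl = kept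
  ... | no j≢k   = subst (SignKept (lookup x k)) (agree k j≢k) (sign-kept (≼-refl x) k)

sign-kept-+1 : ∀ {a} → 0ℤ ℤ.≤ a → SignKept a (a ℤ.+ + 1)
sign-kept-+1 (ℤ.+≤+ {n = n} _) = (λ _ → ℤ.+<+ (ℕP.m≤n+m 1 n)) , λ { (ℤ.+<+ ()) }

sign-kept--1 : ∀ {a} → a ℤ.≤ 0ℤ → SignKept a (a ℤ.- + 1)
sign-kept--1 ℤ.-≤+         = (λ ()) , (λ _ → ℤ.-<+)
sign-kept--1 (ℤ.+≤+ z≤n)   = (λ { (ℤ.+<+ ()) }) , (λ { (ℤ.+<+ ()) })

≼-⊕ : ∀ {d} (x : Point d) j → 0ℤ ℤ.≤ lookup x j → x ≼ (x ⊕ e j)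
≼-⊕ x j 0≤xⱼ = ≼-change x (x ⊕ e j) j (λ k j≢k → sym (⊕-other x j≢k))
  (subst (SignKept (lookup x j)) (sym (⊕-same x j)) (sign-kept-+1 0≤xⱼ))

≼-⊖ : ∀ {d} (x : Point d) j → lookup x j ℤ.≤ 0ℤ → x ≼ (x ⊖ e j)
≼-⊖ x j xⱼ≤0 = ≼-change x (x ⊖ e j) j (λ k j≢k → sym (⊖-other x j≢k))
  (subst (SignKept (lookup x j)) (sym (⊖-same x j)) (sign-kept--1 xⱼ≤0))

≼-nonzero : ∀ {d} {x w : Point d} k → x ≼ w → lookup x k ≢ + 0 → lookup w k ≢ + 0
≼-nonzero {x = x} k x≼w xₖ≢0 = nonzero (lookup x k) xₖ≢0 (sign-kept x≼w k)
  where
  nonzero : ∀ a {b} → a ≢ + 0 → SignKept a b → b ≢ + 0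
  nonzero (+ 0)    a≢0 _         = ⊥-elim (a≢0 refl)
  nonzero +[1+ n ] _   (pos , _) = ℤP.<⇒≢ (pos (ℤ.+<+ (s≤s z≤n))) ∘ sym
  nonzero -[1+ n ] _   (_ , neg) = ℤP.<⇒≢ (neg ℤ.-<+)

data Opposite {d} (k : Fin d) (x u : Point d) : Set where
  pos-neg : 0ℤ ℤ.< lookup x k → lookup u k ℤ.< 0ℤ → Opposite k x u
  neg-pos : lookup x k ℤ.< 0ℤ → 0ℤ ℤ.< lookup u k → Opposite k x u

opposite-≢ : ∀ {d} {x u : Point d} k → Opposite k x u → x ≢ u
opposite-≢ k (pos-neg pos neg) refl = ℤP.<-asym pos neg
opposite-≢ k (neg-pos neg pos) refl = ℤP.<-asym pos neg

opposite-sym : ∀ {d} {x u : Point d} k → Opposite k x u → Opposite k u x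
opposite-sym k (pos-neg pos neg) = neg-pos neg pos
opposite-sym k (neg-pos neg pos) = pos-neg pos neg

axis-ends-opposite : ∀ {d n} (j : Fin d) → 1 ≤ n → Opposite j ((+ n) · e j) ((- (+ n)) · e j)
axis-ends-opposite {n = n} j (s≤s z≤n) =
  pos-neg (subst (0ℤ ℤ.<_) (sym (lookup-axis-same (+ n) j)) (ℤ.+<+ (s≤s z≤n)))
          (subst (ℤ._< 0ℤ) (sym (lookup-axis-same (- (+ n)) j)) ℤ.-<+)

opposite-≼ : ∀ {d} {x u w v : Point d} k → x ≼ w → u ≼ v → Opposite k x u → Opposite k w v
opposite-≼ k x≼w u≼v (pos-neg pos neg) = pos-neg (proj₁ (sign-kept x≼w k) pos) (proj₂ (sign-kept u≼v k) neg)
opposite-≼ k x≼w u≼v (neg-pos neg pos) = neg-pos (proj₂ (sign-kept x≼w k) neg) (proj₁ (sign-kept u≼v k) pos)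

module Process (d t : ℕ) (A : Point d → Set) where

  open RawMonad (¬¬-Monad {0ℓ}) using (pure; _>>=_)

  Prot : Point d → Set
  Prot = Protected A t

  -- Being protected is a negative statement apart from ‖x‖ ≤ t, so it is ¬¬-stable.
  protected-stable : ∀ x → ‖ x ‖ ≤ t → ¬ ¬ Prot x → Prot x
  protected-stable x ‖x‖≤t ¬¬prot = ‖x‖≤t , λ infected → ¬¬prot (λ prot → proj₂ prot infected)

  -- Direction j is open at x if neither neighbour x ∓ e_j is infected at time t - ‖x‖ - 1,
  -- the time at which points one sphere further out are tested.
  Open : Point d → Fin d → Set
  Open x j = ¬ Step A (t ∸ suc ‖ x ‖) (x ⊖ e j) × ¬ Step A (t ∸ suc ‖ x ‖) (x ⊕ e j)

  -- A protected x with ‖x‖ < t is not infected at time (t - ‖x‖ - 1) + 1, so by the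
  -- update rule some direction is open at x.
  open-direction : ∀ x → Prot x → ‖ x ‖ ℕ.< t → ¬ ¬ Σ (Fin d) (Open x)
  open-direction x (_ , uninfected) ‖x‖<t no-open-direction =
    ¬¬-∀-Fin neighbour-infected λ all-infected →
      uninfected (subst (λ s → Step A s x) (sym (ℕP.+-∸-assoc 1 ‖x‖<t)) (inj₂ all-infected))
    where
    neighbour-infected : ∀ j → ¬ ¬ (Step A (t ∸ suc ‖ x ‖) (x ⊖ e j) ⊎ Step A (t ∸ suc ‖ x ‖) (x ⊕ e j))
    neighbour-infected j neither = no-open-direction (j , neither ∘ inj₁ , neither ∘ inj₂)

  protected-⊕ : ∀ x j → ‖ x ‖ ℕ.< t → 0ℤ ℤ.≤ lookup x j →
    ¬ Step A (t ∸ suc ‖ x ‖) (x ⊕ e j) → Prot (x ⊕ e j)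
  protected-⊕ x j ‖x‖<t 0≤xⱼ uninfected rewrite ‖⊕‖ x j 0≤xⱼ = ‖x‖<t , uninfected

  protected-⊖ : ∀ x j → ‖ x ‖ ℕ.< t → lookup x j ℤ.≤ 0ℤ →
    ¬ Step A (t ∸ suc ‖ x ‖) (x ⊖ e j) → Prot (x ⊖ e j)
  protected-⊖ x j ‖x‖<t xⱼ≤0 uninfected rewrite ‖⊖‖ x j xⱼ≤0 = ‖x‖<t , uninfected

  Extension : ℕ → Point d → Set
  Extension r x = Σ (Point d) λ w → Prot w × ‖ w ‖ ≡ r × x ≼ w

  step-out : ∀ x → Prot x → ‖ x ‖ ℕ.< t → ¬ ¬ Extension (suc ‖ x ‖) x
  step-out x prot ‖x‖<t = do
    (j , open-j) ← open-direction x prot ‖x‖<t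
    pure (outwards j open-j (ℤP.≤-total 0ℤ (lookup x j)))
    where
    outwards : ∀ j → Open x j → (0ℤ ℤ.≤ lookup x j) ⊎ (lookup x j ℤ.≤ 0ℤ) → Extension (suc ‖ x ‖) x
    outwards j (_ , plus-uninfected) (inj₁ 0≤xⱼ) =
      x ⊕ e j , protected-⊕ x j ‖x‖<t 0≤xⱼ plus-uninfected , ‖⊕‖ x j 0≤xⱼ , ≼-⊕ x j 0≤xⱼ
    outwards j (minus-uninfected , _) (inj₂ xⱼ≤0) =
      x ⊖ e j , protected-⊖ x j ‖x‖<t xⱼ≤0 minus-uninfected , ‖⊖‖ x j xⱼ≤0 , ≼-⊖ x j xⱼ≤0

  extend-to-sphere : ∀ {r} → r ≤ t → ∀ x → Prot x → ‖ x ‖ ≤ r → ¬ ¬ Extension r x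
  extend-to-sphere {r} r≤t x prot ‖x‖≤r = extend (r ∸ ‖ x ‖) x prot (ℕP.m+[n∸m]≡n ‖x‖≤r)
    where
    extend : ∀ n x → Prot x → ‖ x ‖ ℕ.+ n ≡ r → ¬ ¬ Extension r x
    extend zero    x prot ‖x‖+0≡r = pure (x , prot , trans (sym (ℕP.+-identityʳ _)) ‖x‖+0≡r , ≼-refl x)
    extend (suc n) x prot ‖x‖+n+1≡r = do
      (x′ , prot′ , ‖x′‖≡ , x≼x′) ← step-out x prot ‖x‖<t
      (w , protw , ‖w‖≡r , x′≼w) ← extend n x′ prot′ (trans (cong (ℕ._+ n) ‖x′‖≡) ‖x‖+1+n≡r)
      pure (w , protw , ‖w‖≡r , ≼-trans x≼x′ x′≼w)
      where
      ‖x‖+1+n≡r : suc ‖ x ‖ ℕ.+ n ≡ r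
      ‖x‖+1+n≡r = trans (sym (ℕP.+-suc ‖ x ‖ n)) ‖x‖+n+1≡r
      ‖x‖<t : ‖ x ‖ ℕ.< t
      ‖x‖<t = ℕP.<-≤-trans (ℕP.m<m+n ‖ x ‖ (s≤s z≤n)) (subst (_≤ t) (sym ‖x‖+n+1≡r) r≤t)

  AxisProtected : Fin d → ℕ → Set
  AxisProtected j n = Prot ((+ n) · e j) × Prot ((- (+ n)) · e j)

  first-axis-step : 1 ≤ t → Prot origin → ¬ ¬ Σ (Fin d) λ j → AxisProtected j 1
  first-axis-step 1≤t prot = do
    (j , minus-uninfected , plus-uninfected) ← open-direction origin prot ‖0‖<t
    pure (j , subst Prot (trans (cong (_⊕ e j) (origin-on-axis j)) (⊕-axis (+ 0) j))
                    (protected-⊕ origin j ‖0‖<t (0≤0ⱼ j) plus-uninfected)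
            , subst Prot (trans (cong (_⊖ e j) (origin-on-axis j)) (⊖-axis (+ 0) j))
                    (protected-⊖ origin j ‖0‖<t (0ⱼ≤0 j) minus-uninfected))
    where
    ‖0‖<t : ‖ origin {d} ‖ ℕ.< t
    ‖0‖<t = subst (ℕ._< t) (sym (‖origin‖ {d})) 1≤t
    0≤0ⱼ : ∀ j → 0ℤ ℤ.≤ lookup origin j
    0≤0ⱼ j = subst (0ℤ ℤ.≤_) (sym (VecP.lookup-replicate j (+ 0))) ℤP.≤-refl
    0ⱼ≤0 : ∀ j → lookup origin j ℤ.≤ 0ℤ
    0ⱼ≤0 j = subst (ℤ._≤ 0ℤ) (sym (VecP.lookup-replicate j (+ 0))) ℤP.≤-refl

  module AtMostTwoOnSphere (r : ℕ) (r≤t : r ≤ t) (y z : Point d)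
    (at-most-two : ∀ w → ‖ w ‖ ≡ r → Prot w → (w ≡ y) ⊎ (w ≡ z)) where

    -- Points pairwise on opposite sides of coordinate hyperplanes have pairwise distinct
    -- extensions, so at most two of them can extend to S_r.
    no-three-opposite : ∀ {x₁ x₂ x₃} k₁₂ k₁₃ k₂₃ →
      Opposite k₁₂ x₁ x₂ → Opposite k₁₃ x₁ x₃ → Opposite k₂₃ x₂ x₃ →
      Extension r x₁ → Extension r x₂ → Extension r x₃ → ⊥
    no-three-opposite k₁₂ k₁₃ k₂₃ x₁∣x₂ x₁∣x₃ x₂∣x₃
      (w₁ , prot₁ , ‖w₁‖≡r , x₁≼w₁) (w₂ , prot₂ , ‖w₂‖≡r , x₂≼w₂) (w₃ , prot₃ , ‖w₃‖≡r , x₃≼w₃) =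
      pigeonhole (at-most-two w₁ ‖w₁‖≡r prot₁) (at-most-two w₂ ‖w₂‖≡r prot₂) (at-most-two w₃ ‖w₃‖≡r prot₃)
        (opposite-≢ k₁₂ (opposite-≼ k₁₂ x₁≼w₁ x₂≼w₂ x₁∣x₂))
        (opposite-≢ k₁₃ (opposite-≼ k₁₃ x₁≼w₁ x₃≼w₃ x₁∣x₃))
        (opposite-≢ k₂₃ (opposite-≼ k₂₃ x₂≼w₂ x₃≼w₃ x₂∣x₃))

    -- A protected x inside S_r with an open direction j along which x_j = 0 branches into
    -- the protected points x ± e_j, on opposite sides of {v_j = 0}.  Any protected u ∈ B_r
    -- opposite to x along some coordinate k would then give three opposite points.
    no-branching : ∀ x u j k → Prot x → ‖ x ‖ ℕ.< r → Open x j → lookup x j ≡ + 0 →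
      Prot u → ‖ u ‖ ≤ r → Opposite k x u → ⊥
    no-branching x u j k prot ‖x‖<r (minus-uninfected , plus-uninfected) xⱼ≡0 protu ‖u‖≤r x∣u =
      extend-to-sphere r≤t (x ⊕ e j) prot⁺ (subst (_≤ r) (sym (‖⊕‖ x j 0≤xⱼ)) ‖x‖<r) λ ext⁺ →
      extend-to-sphere r≤t (x ⊖ e j) prot⁻ (subst (_≤ r) (sym (‖⊖‖ x j xⱼ≤0)) ‖x‖<r) λ ext⁻ →
      extend-to-sphere r≤t u protu ‖u‖≤r λ extᵤ →
      no-three-opposite j k k split
        (opposite-≼ k (≼-⊕ x j 0≤xⱼ) (≼-refl u) x∣u) (opposite-≼ k (≼-⊖ x j xⱼ≤0) (≼-refl u) x∣u)
        ext⁺ ext⁻ extᵤ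
      where
      ‖x‖<t : ‖ x ‖ ℕ.< t
      ‖x‖<t = ℕP.<-≤-trans ‖x‖<r r≤t
      0≤xⱼ : 0ℤ ℤ.≤ lookup x j
      0≤xⱼ = subst (0ℤ ℤ.≤_) (sym xⱼ≡0) ℤP.≤-refl
      xⱼ≤0 : lookup x j ℤ.≤ 0ℤ
      xⱼ≤0 = subst (ℤ._≤ 0ℤ) (sym xⱼ≡0) ℤP.≤-refl
      prot⁺ : Prot (x ⊕ e j)
      prot⁺ = protected-⊕ x j ‖x‖<t 0≤xⱼ plus-uninfected
      prot⁻ : Prot (x ⊖ e j)
      prot⁻ = protected-⊖ x j ‖x‖<t xⱼ≤0 minus-uninfected
      split : Opposite j (x ⊕ e j) (x ⊖ e j)
      split = pos-neg (subst (0ℤ ℤ.<_) (sym (trans (⊕-same x j) (cong (ℤ._+ + 1) xⱼ≡0))) (ℤ.+<+ (s≤s z≤n)))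
                      (subst (ℤ._< 0ℤ) (sym (trans (⊖-same x j) (cong (ℤ._- + 1) xⱼ≡0))) ℤ.-<+)

    -- If the axis point s·e_j inside S_r is opposite along j to another protected axis point
    -- of B_r, its only possible open direction is j itself: any other would be branching.
    only-axis-open : ∀ j s s′ → Prot (s · e j) → ‖ s · e j ‖ ℕ.< r →
      Prot (s′ · e j) → ‖ s′ · e j ‖ ≤ r → Opposite j (s · e j) (s′ · e j) → ¬ ¬ Open (s · e j) j
    only-axis-open j s s′ prot ‖x‖<r prot′ ‖x′‖≤r opposite = do
      (j′ , open-j′) ← open-direction (s · e j) prot (ℕP.<-≤-trans ‖x‖<r r≤t)
      pure (along j′ open-j′)
      where
      along : ∀ j′ → Open (s · e j) j′ → Open (s · e j) j
      along j′ open-j′ with j ≟ j′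
      ... | yes refl = open-j′
      ... | no j≢j′  = ⊥-elim (no-branching (s · e j) (s′ · e j) j′ j prot ‖x‖<r open-j′
                                 (lookup-axis-other s j≢j′) prot′ ‖x′‖≤r opposite)

    -- One step along the axis: the endpoints ±(n+1)·e_j (with n + 1 < r) lie opposite to
    -- each other, so each can only be left outwards along the axis, giving ±(n+2)·e_j.
    axis-step : ∀ j n → suc (suc n) ≤ r → AxisProtected j (suc n) → AxisProtected j (suc (suc n))
    axis-step j n n+2≤r (prot⁺ , prot⁻) = grow⁺ , grow⁻
      where
      inside : ∀ s → ∣ s ∣ ≡ suc n → ‖ s · e j ‖ ℕ.< r
      inside s ∣s∣≡ = subst (ℕ._< r) (sym (trans (‖axis‖ s j) ∣s∣≡)) n+2≤r
      ‖next‖≤t : ∀ s → ∣ s ∣ ≡ suc (suc n) → ‖ s · e j ‖ ≤ t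
      ‖next‖≤t s ∣s∣≡ = subst (_≤ t) (sym (trans (‖axis‖ s j) ∣s∣≡)) (ℕP.≤-trans n+2≤r r≤t)
      ends : Opposite j ((+ suc n) · e j) (-[1+ n ] · e j)
      ends = axis-ends-opposite {n = suc n} j (s≤s z≤n)
      grow⁺ : Prot ((+ suc (suc n)) · e j)
      grow⁺ = protected-stable ((+ suc (suc n)) · e j) (‖next‖≤t (+ suc (suc n)) refl) (do
        (_ , plus-uninfected) ← only-axis-open j (+ suc n) -[1+ n ] prot⁺ (inside (+ suc n) refl)
                                  prot⁻ (ℕP.<⇒≤ (inside -[1+ n ] refl)) ends
        pure (subst Prot (trans (⊕-axis (+ suc n) j) (cong (λ m → (+ m) · e j) (ℕP.+-comm (suc n) 1)))
               (protected-⊕ ((+ suc n) · e j) j (ℕP.<-≤-trans (inside (+ suc n) refl) r≤t)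
                 (subst (0ℤ ℤ.≤_) (sym (lookup-axis-same (+ suc n) j)) (ℤ.+≤+ z≤n)) plus-uninfected)))
      grow⁻ : Prot (-[1+ suc n ] · e j)
      grow⁻ = protected-stable (-[1+ suc n ] · e j) (‖next‖≤t -[1+ suc n ] refl) (do
        (minus-uninfected , _) ← only-axis-open j -[1+ n ] (+ suc n) prot⁻ (inside -[1+ n ] refl)
                                   prot⁺ (ℕP.<⇒≤ (inside (+ suc n) refl)) (opposite-sym j ends)
        pure (subst Prot (trans (⊖-axis -[1+ n ] j) (cong (λ m → -[1+ suc m ] · e j) (ℕP.+-identityʳ n)))
               (protected-⊖ (-[1+ n ] · e j) j (ℕP.<-≤-trans (inside -[1+ n ] refl) r≤t)
                 (subst (ℤ._≤ 0ℤ) (sym (lookup-axis-same -[1+ n ] j)) ℤ.-≤+) minus-uninfected)))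

    axis-protected : ∀ j → Prot origin → AxisProtected j 1 → ∀ n → n ≤ r → AxisProtected j n
    axis-protected j prot₀ _ zero _ = prot-origin , prot-origin
      where
      prot-origin : Prot ((+ 0) · e j)
      prot-origin = subst Prot (origin-on-axis j) prot₀
    axis-protected j prot₀ first (suc zero) _ = first
    axis-protected j prot₀ first (suc (suc n)) n+2≤r =
      axis-step j n n+2≤r (axis-protected j prot₀ first (suc n) (ℕP.≤-trans (ℕP.n≤1+n (suc n)) n+2≤r))

    SphereOnAxis : Fin d → Set
    SphereOnAxis j = ∀ w → ‖ w ‖ ≡ r → Prot w → ∀ k → j ≢ k → lookup w k ≡ + 0

    -- Once ±r·e_j are protected they are the two protected points of S_r, so no protected
    -- point of S_r leaves the axis: it would be a third one.
    sphere-on-axis : ∀ j → 1 ≤ r → AxisProtected j r → SphereOnAxis j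
    sphere-on-axis j 1≤r (prot⁺ , prot⁻) w ‖w‖≡r protw k j≢k =
      decidable-stable (lookup w k ℤ.≟ + 0) λ wₖ≢0 →
        pigeonhole (at-most-two w ‖w‖≡r protw)
                   (at-most-two ((+ r) · e j) (‖axis‖ (+ r) j) prot⁺)
                   (at-most-two ((- (+ r)) · e j) (trans (‖axis‖ (- (+ r)) j) (ℤP.∣-i∣≡∣i∣ (+ r))) prot⁻)
                   (off-axis (+ r) wₖ≢0) (off-axis (- (+ r)) wₖ≢0) (opposite-≢ j (axis-ends-opposite j 1≤r))
      where
      off-axis : ∀ s → lookup w k ≢ + 0 → w ≢ s · e j
      off-axis s wₖ≢0 w≡ = wₖ≢0 (trans (cong (λ v → lookup v k) w≡) (lookup-axis-other s j≢k))

    AxisStructure : Fin d → Set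
    AxisStructure j = (∀ n → n ≤ r → AxisProtected j n) × SphereOnAxis j

    -- The origin opens some axis j, which grows up to ±r·e_j and then carries S_r's
    -- protected points; any protected w ∈ S_r with w_i ≠ 0 then forces i = j.
    axis-structure : 1 ≤ r → Prot origin → ∀ w i → ‖ w ‖ ≡ r → Prot w → lookup w i ≢ + 0 →
      ¬ ¬ AxisStructure i
    axis-structure 1≤r prot₀ w i ‖w‖≡r protw wᵢ≢0 = do
      (j , first) ← first-axis-step (ℕP.≤-trans 1≤r r≤t) prot₀
      let axis : ∀ n → n ≤ r → AxisProtected j n
          axis = axis-protected j prot₀ first
          on-axis : SphereOnAxis j
          on-axis = sphere-on-axis j 1≤r (axis r ℕP.≤-refl)
          j≡i : j ≡ i
          j≡i = decidable-stable (j Fin.≟ i) λ j≢i → wᵢ≢0 (on-axis w ‖w‖≡r protw i j≢i)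
      pure (subst AxisStructure j≡i (axis , on-axis))

    -- Protected points of B_r lie on the axis i: a nonzero coordinate off the axis would
    -- survive in the extension to S_r.
    protected⇒on-axis : ∀ i → ¬ ¬ SphereOnAxis i → ∀ x → ‖ x ‖ ≤ r → Prot x → x ≡ lookup x i · e i
    protected⇒on-axis i ¬¬on-axis x ‖x‖≤r prot = coordinatewise coordinate
      where
      coordinate : ∀ k → lookup x k ≡ lookup (lookup x i · e i) k
      coordinate k with i ≟ k
      ... | yes refl = sym (lookup-axis-same (lookup x i) i)
      ... | no i≢k   = trans xₖ≡0 (sym (lookup-axis-other (lookup x i) i≢k))
        where
        xₖ≡0 : lookup x k ≡ + 0
        xₖ≡0 = decidable-stable (lookup x k ℤ.≟ + 0) λ xₖ≢0 →
          ¬¬on-axis λ on-axis → extend-to-sphere r≤t x prot ‖x‖≤r λ (w , protw , ‖w‖≡r , x≼w) →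
            ≼-nonzero k x≼w xₖ≢0 (on-axis w ‖w‖≡r protw k i≢k)

    on-axis⇒protected : ∀ i → ¬ ¬ (∀ n → n ≤ r → AxisProtected i n) → ∀ s → ∣ s ∣ ≤ r → Prot (s · e i)
    on-axis⇒protected i ¬¬axis s ∣s∣≤r =
      protected-stable (s · e i) (subst (_≤ t) (sym (‖axis‖ s i)) (ℕP.≤-trans ∣s∣≤r r≤t))
        (¬¬-map (λ axis → axis-point s (axis ∣ s ∣ ∣s∣≤r)) ¬¬axis)
      where
      axis-point : ∀ s → AxisProtected i ∣ s ∣ → Prot (s · e i)
      axis-point (+ n)      = proj₁
      axis-point -[1+ n ]   = proj₂

-- Lemma 5.1.  The axis i is read off from the protected sphere point y; the protected sites
-- of B_r are then exactly the axis points s·e_i with |s| ≤ r.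
lemma5p1 : (d t : ℕ) → d ≥ 2 → t ≥ 1 → (A : Point d → Set) →
    Protected A t origin →
    (r : ℕ) → 1 ≤ r → r ≤ t →
    (Σ (Point d) λ y → Σ (Point d) λ z →
      ¬ (y ≡ z) ×
      (‖ y ‖ ≡ r × Protected A t y) ×
      (‖ z ‖ ≡ r × Protected A t z) ×
      ((w : Point d) → ‖ w ‖ ≡ r → Protected A t w → (w ≡ y) ⊎ (w ≡ z))) →
    Σ (Fin d) λ i → (x : Point d) →
      (((‖ x ‖ ≤ r) × Protected A t x) →
        Σ ℤ λ s → ((- (+ r)) ℤ.≤ s × s ℤ.≤ + r) × (x ≡ s · e i)) ×
      ((Σ ℤ λ s → ((- (+ r)) ℤ.≤ s × s ℤ.≤ + r) × (x ≡ s · e i)) →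
        (‖ x ‖ ≤ r) × Protected A t x)
lemma5p1 d t _ _ A prot₀ r 1≤r r≤t (y , z , _ , (‖y‖≡r , prot-y) , _ , at-most-two) =
  i , λ x → protected⇒axis-point x , axis-point⇒protected x
  where
  open Process d t A
  open AtMostTwoOnSphere r r≤t y z at-most-two

  ‖y‖≢0 : ‖ y ‖ ≢ 0
  ‖y‖≢0 ‖y‖≡0 = ℕP.<⇒≢ 1≤r (sym (trans (sym ‖y‖≡r) ‖y‖≡0))

  i : Fin d
  i = proj₁ (nonzero-coordinate y ‖y‖≢0)

  structure : ¬ ¬ AxisStructure i
  structure = axis-structure 1≤r prot₀ y i ‖y‖≡r prot-y (proj₂ (nonzero-coordinate y ‖y‖≢0))

  protected⇒axis-point : ∀ x → ‖ x ‖ ≤ r × Prot x →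
    Σ ℤ λ s → (- (+ r) ℤ.≤ s × s ℤ.≤ + r) × (x ≡ s · e i)
  protected⇒axis-point x (‖x‖≤r , prot) =
    lookup x i , ∣∣≤⇒bounded (subst (_≤ r) ‖x‖≡∣xᵢ∣ ‖x‖≤r) , x-on-axis
    where
    x-on-axis : x ≡ lookup x i · e i
    x-on-axis = protected⇒on-axis i (¬¬-map proj₂ structure) x ‖x‖≤r prot
    ‖x‖≡∣xᵢ∣ : ‖ x ‖ ≡ ∣ lookup x i ∣
    ‖x‖≡∣xᵢ∣ = trans (cong ‖_‖ x-on-axis) (‖axis‖ (lookup x i) i)

  axis-point⇒protected : ∀ x → (Σ ℤ λ s → (- (+ r) ℤ.≤ s × s ℤ.≤ + r) × (x ≡ s · e i)) →
    ‖ x ‖ ≤ r × Prot x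
  axis-point⇒protected x (s , (-r≤s , s≤r) , refl) =
    subst (_≤ r) (sym (‖axis‖ s i)) ∣s∣≤r , on-axis⇒protected i (¬¬-map proj₁ structure) s ∣s∣≤r
    where
    ∣s∣≤r : ∣ s ∣ ≤ r
    ∣s∣≤r = bounded⇒∣∣≤ -r≤s s≤r
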